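{- Let $G=(V,E)$ be a simple undirected graph, let $k$ be a positive integer and $K=\{1,\dots,k\}$. Let $Q$ be the reversible clique partition of $G$ and $G'=(Q,E')$ the graph induced by it, where $E'=\{\{q_u,q_v\} : \{u,v\}\in E,\ q_u,q_v\in Q,\ q_u\neq q_v,\ u\in q_u,\ v\in q_v\}$. Define the demand $f:Q\to\mathbb{N}$ by $f(q)=|q|$. Then $G$ admits a proper vertex colouring with colours from $K$ (a map $c:V\to K$ with $c(u)\neq c(v)$ for all $\{u,v\}\in E$) if and only if $G'$ admits a multicolouring with colours from $K$ and demand $f$, i.e. a map $c':Q\to 2^K$ with $|c'(q)|=f(q)$ for all $q\in Q$ and $c'(q)\cap c'(q')=\emptyset$ for all $\{q,q'\}\in E'$.
   Context: Graphs are simple, undirected, and not necessarily connected. Two distinct vertices $u,v$ of $G$ are indistinguishable if they are adjacent and have identical closed neighbourhoods, i.e. $\{w : \{u,w\}\in E\}\cup\{u\} = \{w : \{v,w\}\in E\}\cup\{v\}$ (each vertex is regarded as indistinguishable from itself); this is an equivalence relation. A clique partition of $G$ is a partition of $V$ into sets of pairwise adjacent vertices. The reversible clique partition of $G$ is the clique partition of minimum cardinality whose parts (supernodes) are the equivalence classes of the indistinguishability relation. -}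

module Defs where

open import Data.Nat using (ℕ)
open import Data.Fin using (Fin)
open import Data.Fin.Subset using (Subset; _∈_; _∩_; Empty; ∣_∣)
open import Data.Product using (Σ; ∃; ∃-syntax; _×_)
open import Data.Sum using (_⊎_)
open import Relation.Binary.PropositionalEquality using (_≡_; _≢_)
open import Relation.Nullary using (¬_)
open import Function.Bundles using (_⇔_)
open import Level using (0ℓ; suc)

record Graph (n : ℕ) : Set₁ where
  field
    Adj    : Fin n → Fin n → Set
    sym    : ∀ {u v} → Adj u v → Adj v u
    irrefl : ∀ {u} → ¬ Adj u u

module _ {n : ℕ} (G : Graph n) where
  open Graph G

  InClosedNbhd : Fin n → Fin n → Set
  InClosedNbhd u w = Adj u w ⊎ w ≡ u

  Indist : Fin n → Fin n → Set
  Indist u v = u ≡ v ⊎ (Adj u v × (∀ w → InClosedNbhd u w ⇔ InClosedNbhd v w))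

  -- Q : Fin m → Subset n is (an enumeration without repetition of) the
  -- reversible clique partition of G: a partition of V into nonempty parts
  -- which are exactly the equivalence classes of Indist.
  record IsReversibleCliquePartition {m : ℕ} (Q : Fin m → Subset n) : Set where
    field
      nonempty : ∀ i → ∃[ v ] v ∈ Q i
      cover    : ∀ v → ∃[ i ] v ∈ Q i
      disjoint : ∀ {i j v} → v ∈ Q i → v ∈ Q j → i ≡ j
      classes  : ∀ {i u v} → u ∈ Q i → (v ∈ Q i ⇔ Indist u v)

  IsProperColouring : {k : ℕ} → (Fin n → Fin k) → Set
  IsProperColouring c = ∀ {u v} → Adj u v → c u ≢ c v

  QAdj : {m : ℕ} → (Fin m → Subset n) → Fin m → Fin m → Set
  QAdj Q i j = i ≢ j × ∃[ u ] ∃[ v ] (u ∈ Q i × v ∈ Q j × Adj u v)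

  IsMulticolouring : {m k : ℕ} → (Fin m → Subset n) → (Fin m → Subset k) → Set
  IsMulticolouring Q c′ =
    (∀ i → ∣ c′ i ∣ ≡ ∣ Q i ∣) × (∀ {i j} → QAdj Q i j → Empty (c′ i ∩ c′ j))

-- Indistinguishable vertices have the same neighbours outside their class, so
-- every supernode is a clique, and two supernodes are either completely joined or
-- not joined at all. Hence a proper colouring gives a supernode q exactly |q|
-- distinct colours, which avoid those of every adjacent supernode; conversely a
-- multicolouring hands the |q| colours of q out bijectively to its vertices.
module Submission where

open import Defs
open import Data.Nat using (ℕ; _≥_)
open import Data.Fin using (Fin; zero; suc; _≟_; cast)
open import Data.Fin.Properties using (any?; suc-injective; cantor-schröder-bernstein; cast-involutive)
open import Data.Fin.Subset using (Subset; _∈_; _∩_; Empty; ∣_∣; inside; outside)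
open import Data.Fin.Subset.Properties using (_∈?_; x∈p∩q⁺; x∈p∩q⁻)
open import Data.Vec using (_∷_; here; there; tabulate)
open import Data.Vec.Properties using (lookup∘tabulate; []=⇒lookup; lookup⇒[]=)
open import Data.Product using (∃-syntax; _×_; _,_; proj₁; proj₂)
open import Data.Sum using (inj₁; inj₂)
open import Data.Empty using (⊥-elim)
open import Relation.Unary using (Pred; Decidable)
open import Relation.Nullary using (yes; no; does)
open import Relation.Nullary.Decidable using (_×-dec_; dec-true)
open import Relation.Binary.PropositionalEquality
open import Function.Bundles using (_⇔_; mk⇔; Equivalence)

element : ∀ {n} (p : Subset n) → Fin ∣ p ∣ → Fin n
element (inside  ∷ p) zero    = zero
element (inside  ∷ p) (suc r) = suc (element p r)
element (outside ∷ p) r       = suc (element p r)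

position : ∀ {n} (p : Subset n) {x} → x ∈ p → Fin ∣ p ∣
position (inside  ∷ p) here        = zero
position (inside  ∷ p) (there x∈p) = suc (position p x∈p)
position (outside ∷ p) (there x∈p) = position p x∈p

element∈p : ∀ {n} (p : Subset n) r → element p r ∈ p
element∈p (inside  ∷ p) zero    = here
element∈p (inside  ∷ p) (suc r) = there (element∈p p r)
element∈p (outside ∷ p) r       = there (element∈p p r)

element-position : ∀ {n} (p : Subset n) {x} (x∈p : x ∈ p) → element p (position p x∈p) ≡ x
element-position (inside  ∷ p) here        = refl
element-position (inside  ∷ p) (there x∈p) = cong suc (element-position p x∈p)
element-position (outside ∷ p) (there x∈p) = cong suc (element-position p x∈p)

element-injective : ∀ {n} (p : Subset n) {r s} → element p r ≡ element p s → r ≡ s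
element-injective (inside  ∷ p) {zero}  {zero}  _  = refl
element-injective (inside  ∷ p) {suc r} {suc s} eq =
  cong suc (element-injective p (suc-injective eq))
element-injective (outside ∷ p) eq = element-injective p (suc-injective eq)

position-injective : ∀ {n} (p : Subset n) {x y} (x∈p : x ∈ p) (y∈p : y ∈ p) →
                     position p x∈p ≡ position p y∈p → x ≡ y
position-injective p x∈p y∈p eq = begin
  _                           ≡⟨ element-position p x∈p ⟨
  element p (position p x∈p)  ≡⟨ cong (element p) eq ⟩
  element p (position p y∈p)  ≡⟨ element-position p y∈p ⟩
  _                           ∎
  where open ≡-Reasoning

satisfying : ∀ {n ℓ} {P : Pred (Fin n) ℓ} → Decidable P → Subset n
satisfying P? = tabulate (λ x → does (P? x))

∈-satisfying⁺ : ∀ {n ℓ} {P : Pred (Fin n) ℓ} (P? : Decidable P) {x} → P x → x ∈ satisfying P?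
∈-satisfying⁺ P? {x} px = lookup⇒[]= x _ (trans (lookup∘tabulate _ x) (dec-true (P? x) px))

∈-satisfying⁻ : ∀ {n ℓ} {P : Pred (Fin n) ℓ} (P? : Decidable P) {x} → x ∈ satisfying P? → P x
∈-satisfying⁻ P? {x} x∈
  with P? x | trans (sym (lookup∘tabulate (λ y → does (P? y)) x)) ([]=⇒lookup x∈)
... | yes px | _ = px

image : ∀ {n k} → (Fin n → Fin k) → Subset n → Subset k
image f p = satisfying (λ y → any? (λ x → (x ∈? p) ×-dec (f x ≟ y)))

∈-image⁺ : ∀ {n k} (f : Fin n → Fin k) (p : Subset n) {x} → x ∈ p → f x ∈ image f p
∈-image⁺ f p {x} x∈p = ∈-satisfying⁺ (λ y → any? (λ x → (x ∈? p) ×-dec (f x ≟ y))) (x , x∈p , refl)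

∈-image⁻ : ∀ {n k} (f : Fin n → Fin k) (p : Subset n) {y} →
           y ∈ image f p → ∃[ x ] (x ∈ p × f x ≡ y)
∈-image⁻ f p = ∈-satisfying⁻ (λ y → any? (λ x → (x ∈? p) ×-dec (f x ≟ y)))

InjectiveOn : ∀ {n k} → (Fin n → Fin k) → Subset n → Set
InjectiveOn f p = ∀ {x y} → x ∈ p → y ∈ p → f x ≡ f y → x ≡ y

∣image∣≡∣p∣ : ∀ {n k} (f : Fin n → Fin k) (p : Subset n) → InjectiveOn f p →
              ∣ image f p ∣ ≡ ∣ p ∣
∣image∣≡∣p∣ f p f-inj = cantor-schröder-bernstein {f = toDomain} {g = toImage}
                          toDomain-injective toImage-injective
  where
  preimage : ∀ t → ∃[ x ] (x ∈ p × f x ≡ element (image f p) t)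
  preimage t = ∈-image⁻ f p (element∈p (image f p) t)

  toDomain : Fin ∣ image f p ∣ → Fin ∣ p ∣
  toDomain t = position p (proj₁ (proj₂ (preimage t)))

  toDomain-injective : ∀ {t u} → toDomain t ≡ toDomain u → t ≡ u
  toDomain-injective {t} {u} eq = element-injective (image f p) (begin
    element (image f p) t  ≡⟨ proj₂ (proj₂ (preimage t)) ⟨
    f (proj₁ (preimage t)) ≡⟨ cong f (position-injective p _ _ eq) ⟩
    f (proj₁ (preimage u)) ≡⟨ proj₂ (proj₂ (preimage u)) ⟩
    element (image f p) u  ∎)
    where open ≡-Reasoning

  toImage : Fin ∣ p ∣ → Fin ∣ image f p ∣
  toImage r = position (image f p) (∈-image⁺ f p (element∈p p r))

  toImage-injective : ∀ {r s} → toImage r ≡ toImage s → r ≡ s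
  toImage-injective {r} {s} eq = element-injective p
    (f-inj (element∈p p r) (element∈p p s) (position-injective (image f p) _ _ eq))

module _ {n k} (p : Subset n) (q : Subset k) (∣q∣≡∣p∣ : ∣ q ∣ ≡ ∣ p ∣) where

  relabel : ∀ {x} → x ∈ p → Fin k
  relabel x∈p = element q (cast (sym ∣q∣≡∣p∣) (position p x∈p))

  relabel∈q : ∀ {x} (x∈p : x ∈ p) → relabel x∈p ∈ q
  relabel∈q x∈p = element∈p q _

  relabel-injective : ∀ {x y} (x∈p : x ∈ p) (y∈p : y ∈ p) → relabel x∈p ≡ relabel y∈p → x ≡ y
  relabel-injective x∈p y∈p eq = position-injective p x∈p y∈p (begin
    position p x∈p                                  ≡⟨ cast-involutive ∣q∣≡∣p∣ (sym ∣q∣≡∣p∣) _ ⟨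
    cast ∣q∣≡∣p∣ (cast (sym ∣q∣≡∣p∣) (position p x∈p)) ≡⟨ cong (cast ∣q∣≡∣p∣) (element-injective q eq) ⟩
    cast ∣q∣≡∣p∣ (cast (sym ∣q∣≡∣p∣) (position p y∈p)) ≡⟨ cast-involutive ∣q∣≡∣p∣ (sym ∣q∣≡∣p∣) _ ⟩
    position p y∈p                                  ∎)
    where open ≡-Reasoning

module _ {n m} {G : Graph n} {Q : Fin m → Subset n} (RCP : IsReversibleCliquePartition G Q) where
  open Graph G renaming (sym to Adj-sym)
  open IsReversibleCliquePartition RCP

  part-isClique : ∀ {i u v} → u ∈ Q i → v ∈ Q i → u ≢ v → Adj u v
  part-isClique u∈Qi v∈Qi u≢v with Equivalence.to (classes u∈Qi) v∈Qi
  ... | inj₁ u≡v      = ⊥-elim (u≢v u≡v)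
  ... | inj₂ (uv , _) = uv

  part-closedNbhd : ∀ {i u v w} → u ∈ Q i → v ∈ Q i → InClosedNbhd G u w → InClosedNbhd G v w
  part-closedNbhd u∈Qi v∈Qi w∈N[u] with Equivalence.to (classes u∈Qi) v∈Qi
  ... | inj₁ refl             = w∈N[u]
  ... | inj₂ (_ , N[u]≡N[v]) = Equivalence.to (N[u]≡N[v] _) w∈N[u]

  -- The witnesses of QAdj are moved to u and v one side at a time; an endpoint
  -- landing on the other vertex would put it in both parts.
  QAdj⇒Adj : ∀ {i j u v} → QAdj G Q i j → u ∈ Q i → v ∈ Q j → Adj u v
  QAdj⇒Adj (i≢j , u′ , v′ , u′∈Qi , v′∈Qj , u′v′) u∈Qi v∈Qj
    with part-closedNbhd u′∈Qi u∈Qi (inj₁ u′v′)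
  ... | inj₂ refl = ⊥-elim (i≢j (disjoint u∈Qi v′∈Qj))
  ... | inj₁ uv′ with part-closedNbhd v′∈Qj v∈Qj (inj₁ (Adj-sym uv′))
  ...   | inj₁ vu   = Adj-sym vu
  ...   | inj₂ refl = ⊥-elim (i≢j (disjoint u∈Qi v∈Qj))

  module _ {k} {c : Fin n → Fin k} (c-proper : IsProperColouring G c) where

    properColouring-injectiveOnPart : ∀ i → InjectiveOn c (Q i)
    properColouring-injectiveOnPart i {u} {v} u∈Qi v∈Qi cu≡cv with u ≟ v
    ... | yes u≡v = u≡v
    ... | no  u≢v = ⊥-elim (c-proper (part-isClique u∈Qi v∈Qi u≢v) cu≡cv)

    image-disjoint : ∀ {i j} → QAdj G Q i j → Empty (image c (Q i) ∩ image c (Q j))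
    image-disjoint {i} {j} ij (x , x∈∩) =
      let x∈cQi , x∈cQj    = x∈p∩q⁻ (image c (Q i)) (image c (Q j)) x∈∩
          u , u∈Qi , cu≡x = ∈-image⁻ c (Q i) x∈cQi
          v , v∈Qj , cv≡x = ∈-image⁻ c (Q j) x∈cQj
      in c-proper (QAdj⇒Adj ij u∈Qi v∈Qj) (trans cu≡x (sym cv≡x))

    properColouring⇒multicolouring : IsMulticolouring G Q (λ i → image c (Q i))
    properColouring⇒multicolouring =
      (λ i → ∣image∣≡∣p∣ c (Q i) (properColouring-injectiveOnPart i)) , image-disjoint

  module _ {k} {c′ : Fin m → Subset k} (c′-multi : IsMulticolouring G Q c′) where

    partColour : ∀ {i v} → v ∈ Q i → Fin k
    partColour {i} = relabel (Q i) (c′ i) (proj₁ c′-multi i)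

    partColour∈c′ : ∀ {i v} (v∈Qi : v ∈ Q i) → partColour v∈Qi ∈ c′ i
    partColour∈c′ {i} = relabel∈q (Q i) (c′ i) (proj₁ c′-multi i)

    partColour-proper : ∀ {i j u v} (u∈Qi : u ∈ Q i) (v∈Qj : v ∈ Q j) →
                        Adj u v → partColour u∈Qi ≢ partColour v∈Qj
    partColour-proper {i} {j} {u} {v} u∈Qi v∈Qj uv eq with i ≟ j
    ... | yes refl = irrefl (subst (Adj u) (sym u≡v) uv)
      where
      u≡v : u ≡ v
      u≡v = relabel-injective (Q i) (c′ i) (proj₁ c′-multi i) u∈Qi v∈Qj eq
    ... | no i≢j = proj₂ c′-multi (i≢j , u , v , u∈Qi , v∈Qj , uv)
      (partColour u∈Qi , x∈p∩q⁺ (partColour∈c′ u∈Qi , subst (_∈ c′ j) (sym eq) (partColour∈c′ v∈Qj)))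

    multicolouring⇒properColouring : ∃[ c ] IsProperColouring G c
    multicolouring⇒properColouring =
      (λ v → partColour (proj₂ (cover v))) , λ uv → partColour-proper _ _ uv

mainTheorem4 : ∀ {n m : ℕ} (G : Graph n) (k : ℕ) → k ≥ 1 →
    (Q : Fin m → Subset n) → IsReversibleCliquePartition G Q →
    (∃[ c ] IsProperColouring G {k} c) ⇔ (∃[ c′ ] IsMulticolouring G {m} {k} Q c′)
mainTheorem4 G k _ Q RCP = mk⇔
  (λ (c , c-proper) → _ , properColouring⇒multicolouring RCP c-proper)
  (λ (c′ , c′-multi) → multicolouring⇒properColouring RCP c′-multi)
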